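{- Let $4 \le p \le q$ and let $D$ be a strong orientation of $K(3,p,q)$ with diameter two, with parts $V_1=\{x_1,x_2,x_3\}$, $V_2$ ($|V_2|=p$), $V_3$ ($|V_3|=q$). If exactly four of the eight sets $V_2^A$ ($A \subseteq \{1,2,3\}$) are nonempty, then $$q \le \max\left\{1 + 2\binom{p-2}{\lfloor \frac{p-2}{2} \rfloor} + \binom{p-1}{\lfloor \frac{p-1}{2} \rfloor},\ 2 + 2\binom{p-1}{\lfloor \frac{p-1}{2} \rfloor}\right\}.$$
   Context: $K(3,p,q)$ is the complete tripartite graph with parts $V_1=\{x_1,x_2,x_3\}$, $V_2$ of size $p$, $V_3$ of size $q$. A strong orientation is an orientation of all edges making the digraph strongly connected; its diameter is the maximum directed distance between ordered pairs of vertices. Write $u\to v$ if the edge $uv$ is oriented from $u$ to $v$. For $A \subseteq [3]=\{1,2,3\}$, let $N_D^A$ be the set of vertices $w$ such that $x_i \to w$ for all $i \in A$ and $w \to x_j$ for all $j \in [3]\setminus A$, and $V_2^A = V_2 \cap N_D^A$. The eight sets $V_2^A$ partition $V_2$. -}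

module Defs where

open import Data.Nat using (ℕ; zero; suc; _≤_; _+_)
open import Data.Fin using (Fin)
open import Data.Fin.Properties using (any?; all?)
open import Data.Bool using (Bool; true; false; _≟_)
open import Data.Vec using (Vec; []; _∷_; lookup)
open import Data.List using (List; []; _∷_; map; concatMap; length; filter)
open import Data.Product using (∃; ∃-syntax; _×_; _,_)
open import Relation.Binary.PropositionalEquality using (_≡_; _≢_)
open import Relation.Nullary using (¬_)
open import Data.Empty using (⊥)

data Vertex (p q : ℕ) : Set where
  v₁ : Fin 3 → Vertex p q
  v₂ : Fin p → Vertex p q
  v₃ : Fin q → Vertex p q

-- An orientation of K(3,p,q): every edge between different parts gets exactly
-- one direction, recorded by a Boolean.
--   o12 i v ≡ true  means  x_i → v   (false means v → x_i)
--   o13 i w ≡ true  means  x_i → w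
--   o23 v w ≡ true  means  v → w
record Orientation (p q : ℕ) : Set where
  field
    o12 : Fin 3 → Fin p → Bool
    o13 : Fin 3 → Fin q → Bool
    o23 : Fin p → Fin q → Bool

module _ {p q : ℕ} (D : Orientation p q) where
  open Orientation D

  Arc : Vertex p q → Vertex p q → Set
  Arc (v₁ i) (v₂ v) = o12 i v ≡ true
  Arc (v₂ v) (v₁ i) = o12 i v ≡ false
  Arc (v₁ i) (v₃ w) = o13 i w ≡ true
  Arc (v₃ w) (v₁ i) = o13 i w ≡ false
  Arc (v₂ v) (v₃ w) = o23 v w ≡ true
  Arc (v₃ w) (v₂ v) = o23 v w ≡ false
  Arc _ _ = ⊥

  data Walk : ℕ → Vertex p q → Vertex p q → Set where
    here : ∀ {u} → Walk zero u u
    step : ∀ {k u w v} → Arc u w → Walk k w v → Walk (suc k) u v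

  DistLe : ℕ → Vertex p q → Vertex p q → Set
  DistLe k u v = ∃[ m ] (m ≤ k × Walk m u v)

  Strong : Set
  Strong = ∀ u v → ∃[ m ] Walk m u v

  Diameter2 : Set
  Diameter2 = (∀ u v → DistLe 2 u v)
            × (∃[ u ] ∃[ v ] (DistLe 2 u v × ¬ DistLe 1 u v))

  -- V₂^A (A ⊆ [3] given by its characteristic vector) is nonempty:
  -- some v ∈ V₂ with x_i → v for i ∈ A and v → x_j for j ∉ A.
  InV₂ : Vec Bool 3 → Fin p → Set
  InV₂ A v = ∀ i → o12 i v ≡ lookup A i

  allSubsets : List (Vec Bool 3)
  allSubsets =
    concatMap (λ a → concatMap (λ b → map (λ c → a ∷ b ∷ c ∷ []) (true ∷ false ∷ []))
                                     (true ∷ false ∷ []))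
              (true ∷ false ∷ [])

  nonemptyV₂Count : ℕ
  nonemptyV₂Count =
    length (filter (λ A → any? (λ v → all? (λ i → o12 i v ≟ lookup A i))) allSubsets)

{-# OPTIONS --safe #-}
-- Classify the vertices of V₂ and V₃ by their in-neighbourhood in V₁ (their "type").
-- Diameter two forces the arc between v ∈ V₂ and w ∈ V₃ whenever the two types are
-- comparable, so a type occurring in V₂ occurs in no vertex of V₃, and two vertices
-- w₁ ≠ w₂ of V₃ of the same type S must be separated by some v ∈ V₂ with w₁ → v → w₂
-- whose type is incomparable with S. Hence the out-neighbourhoods of the class of S
-- inside these free vertices form an antichain, and Sperner's theorem bounds the class
-- by C(f, ⌊f/2⌋), where f ≤ p − k and k is the number of types present in V₂ that are
-- comparable with S. Summing over the eight types yields, for each of the 70 choices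
-- of four present types, one of eight combinations of 1 and C(p−i, ⌊(p−i)/2⌋),
-- i = 1, 2, 3; each is at most the bound because these coefficients increase with
-- p − i and at least double every two steps. Sperner's theorem itself is proved
-- through the LYM inequality, by induction on the size of the ground set.
module Submission where

open import Data.Bool.Base using (Bool; true; false; if_then_else_; _∧_)
import Data.Bool.Properties as Bool
open import Data.Fin.Base using (Fin; zero; suc; toℕ; fromℕ<)
open import Data.Fin.Patterns using (0F; 1F; 2F; 3F; 4F; 5F; 6F; 7F)
open import Data.Fin.Properties using (_≟_; any?; all?; toℕ-fromℕ<)
import Data.Fin.Properties as Fin
open import Data.Fin.Subset
open import Data.Fin.Subset.Properties
  using (_∈?_; _⊆?_; anySubset?; Empty-unique; ∣⊥∣≡0; ∣∁p∣≡n∸∣p∣; ∣p∣≤n; p⊆q⇒∣p∣≤∣q∣;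
         ⊆-reflexive; x∈∁p⇒x∉p; x∉p⇒x∈∁p; x∈p∩q⁺; x∈p∩q⁻; p∩q⊆p; p─⊥≡p; p─q⊆p;
         x∈p∧x≢y⇒x∈p-y)
import Data.List.Base as List
open import Data.Nat.Base
  using (ℕ; zero; suc; _+_; _*_; _∸_; _⊔_; _≤_; _<_; z≤n; s≤s; _!; ⌊_/2⌋; ⌈_/2⌉;
         NonZero; >-nonZero; _≤′_; ≤′-refl; ≤′-step; _≤‴_; ≤‴-refl; ≤‴-step)
open import Data.Nat.Combinatorics
  using (_C_; nCk+nC[k+1]≡[n+1]C[k+1]; nCk≡n!/k![n-k]!; k![n∸k]!∣n!; [n-k]*d[k+1]≡[k+1]*d[k])
open import Data.Nat.DivMod using (_/_; m*[n/m]≡n)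
open import Data.Nat.Properties
  using (suc-injective; ≤-refl; ≤-trans; ≤-reflexive; ≤-total; <⇒≤; n≤0⇒n≡0; n≤1+n;
         ≤⇒≤′; ≤′⇒≤; ≤⇒≤‴; ≤‴⇒≤; +-identityʳ; *-identityʳ; +-suc; *-assoc; *-comm;
         +-mono-≤; +-monoʳ-≤; *-monoˡ-≤; *-monoʳ-≤; *-cancelˡ-≤; *-cancelʳ-≤; m≤m+n;
         m≤n+m; m≤m⊔n; m≤n⊔m; m⊓n≤m; m⊓n≤n; m∸n+n≡m; ∸-monoʳ-≤; m<n⇒0<n∸m;
         m+n≤o⇒m≤o∸n; m≤n+o⇒m∸n≤o; m*n≢0; _!≢0; ⌊n/2⌋≤n; ⌊n/2⌋+⌈n/2⌉≡n; ⌊n/2⌋≤⌈n/2⌉;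
         ⌊n/2⌋-mono; module ≤-Reasoning)
import Data.Nat.Properties as ℕ
open import Algebra.Properties.Semiring.Sum ℕ.+-*-semiring
  using (sum; sum-syntax; ∑-comm; ∑-distrib-+; sum-cong-≗; sum-replicate-zero)
open import Data.Nat.Tactic.RingSolver using (solve)
open import Data.Product.Base using (_×_; _,_; ∃-syntax; proj₁; proj₂)
open import Data.Sum.Base using (_⊎_; inj₁; inj₂)
import Data.Sum.Base as Sum
open import Data.Vec.Base using (Vec; []; _∷_; lookup; tabulate; here; there)
open import Data.Vec.Properties
  using (≡-dec; lookup∘tabulate; tabulate∘lookup; tabulate-cong; lookup-zipWith;
         []=⇒lookup; lookup⇒[]=)
open import Data.Vec.Membership.DecPropositional (≡-dec {n = 6} ℕ._≟_)
  using () renaming (_∈_ to _∈ᵥ_; _∈?_ to _∈ᵥ?_)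
open import Data.Vec.Relation.Unary.All using (All; []; _∷_)
import Data.Vec.Relation.Unary.All as All
open import Function.Base using (_∘_; case_of_)
open import Function.Bundles using (_⇔_; mk⇔)
open import Level using (Level)
open import Relation.Binary.PropositionalEquality
open import Relation.Nullary.Decidable
  using (Dec; yes; no; does; dec-true; does-⇔; decidable-stable; from-no; ¬?;
         _×-dec_; _⊎-dec_; _→-dec_)
open import Relation.Nullary.Negation using (¬_; contradiction)
open import Relation.Unary using (Pred; Decidable)

open import Defs

private variable
  ℓ : Level
  k m n : ℕ

-- Finite sums and subsets

sum-mono : {f g : Fin n → ℕ} → (∀ i → f i ≤ g i) → sum f ≤ sum g
sum-mono {zero}  f≤g = z≤n
sum-mono {suc n} f≤g = +-mono-≤ (f≤g zero) (sum-mono (f≤g ∘ suc))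

∑-const : ∀ n (c : ℕ) → ∑[ i < n ] c ≡ n * c
∑-const zero    c = refl
∑-const (suc n) c = cong (c +_) (∑-const n c)

∑-point : (x : Fin n) (g : Fin n → ℕ) → ∑[ j < n ] (if does (x ≟ j) then g j else 0) ≡ g x
∑-point {suc n} zero    g = trans (cong (g zero +_) (sum-replicate-zero n)) (+-identityʳ (g zero))
∑-point         (suc x) g = ∑-point x (g ∘ suc)

∈-tabulate⁺ : {f : Fin n → Bool} {i : Fin n} → f i ≡ true → i ∈ tabulate f
∈-tabulate⁺ {f = f} {i} fi≡true = lookup⇒[]= i (tabulate f) (trans (lookup∘tabulate f i) fi≡true)

∈-tabulate⁻ : {f : Fin n → Bool} {i : Fin n} → i ∈ tabulate f → f i ≡ true
∈-tabulate⁻ {f = f} {i} i∈ = trans (sym (lookup∘tabulate f i)) ([]=⇒lookup i∈)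

subset : {P : Pred (Fin n) ℓ} → Decidable P → Subset n
subset P? = tabulate (does ∘ P?)

∈-subset⁺ : {P : Pred (Fin n) ℓ} (P? : Decidable P) {i : Fin n} → P i → i ∈ subset P?
∈-subset⁺ P? {i} Pi = ∈-tabulate⁺ (dec-true (P? i) Pi)

∈-subset⁻ : {P : Pred (Fin n) ℓ} (P? : Decidable P) {i : Fin n} → i ∈ subset P? → P i
∈-subset⁻ P? {i} i∈ with P? i | ∈-tabulate⁻ {f = does ∘ P?} i∈
... | yes Pi | _  = Pi
... | no  _  | ()

Empty⇒∣p∣≡0 : {p : Subset n} → Empty p → ∣ p ∣ ≡ 0
Empty⇒∣p∣≡0 {n} empty = trans (cong ∣_∣ (Empty-unique empty)) (∣⊥∣≡0 n)

length-filter-tabulate : {A : Set} {P : Pred A ℓ} (P? : Decidable P) (f : Fin n → A) →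
                         List.length (List.filter P? (List.tabulate f)) ≡ ∣ subset (P? ∘ f) ∣
length-filter-tabulate {n = zero}  P? f = refl
length-filter-tabulate {n = suc n} P? f with does (P? (f zero))
... | true  = cong suc (length-filter-tabulate P? (f ∘ suc))
... | false = length-filter-tabulate P? (f ∘ suc)

∑∈ : Subset n → (Fin n → ℕ) → ℕ
∑∈ {n} p f = ∑[ x < n ] (if lookup p x then f x else 0)

syntax ∑∈ p (λ x → e) = ∑[ x ∈ p ] e

∑∈-mono : (p : Subset n) {f g : Fin n → ℕ} → (∀ {x} → x ∈ p → f x ≤ g x) →
          ∑[ x ∈ p ] f x ≤ ∑[ x ∈ p ] g x
∑∈-mono p {f} {g} f≤g = sum-mono pointwise
  where
  pointwise : ∀ x → (if lookup p x then f x else 0) ≤ (if lookup p x then g x else 0)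
  pointwise x with lookup p x in x∈p
  ... | true  = f≤g (lookup⇒[]= x p x∈p)
  ... | false = z≤n

∑∈-cong : (p : Subset n) {f g : Fin n → ℕ} → (∀ {x} → x ∈ p → f x ≡ g x) →
          ∑[ x ∈ p ] f x ≡ ∑[ x ∈ p ] g x
∑∈-cong p {f} {g} f≡g = sum-cong-≗ pointwise
  where
  pointwise : ∀ x → (if lookup p x then f x else 0) ≡ (if lookup p x then g x else 0)
  pointwise x with lookup p x in x∈p
  ... | true  = f≡g (lookup⇒[]= x p x∈p)
  ... | false = refl

∑∈-const : (p : Subset n) (c : ℕ) → ∑[ x ∈ p ] c ≡ ∣ p ∣ * c
∑∈-const []            c = refl
∑∈-const (inside ∷ p)  c = cong (c +_) (∑∈-const p c)
∑∈-const (outside ∷ p) c = ∑∈-const p c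

∣p∣≡∑ : (p : Subset n) → ∣ p ∣ ≡ ∑[ x < n ] (if lookup p x then 1 else 0)
∣p∣≡∑ p = trans (sym (*-identityʳ ∣ p ∣)) (sym (∑∈-const p 1))

∑∈-empty : (p : Subset n) (f : Fin n → ℕ) → (∀ {x} → x ∉ p) → ∑[ x ∈ p ] f x ≡ 0
∑∈-empty []            f ∉p = refl
∑∈-empty (inside ∷ p)  f ∉p = contradiction here ∉p
∑∈-empty (outside ∷ p) f ∉p = ∑∈-empty p (f ∘ suc) (∉p ∘ there)

∑∈-single : {x : Fin n} (p : Subset n) (f : Fin n → ℕ) → x ∈ p → (∀ {y} → y ∈ p → y ≡ x) →
            ∑[ y ∈ p ] f y ≡ f x
∑∈-single (inside ∷ p) f here only =
  trans (cong (f zero +_) (∑∈-empty p (f ∘ suc) λ y∈p → case only (there y∈p) of λ ())) (+-identityʳ (f zero))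
∑∈-single (inside ∷ p)  f (there x∈p) only = case only here of λ ()
∑∈-single (outside ∷ p) f (there x∈p) only = ∑∈-single p (f ∘ suc) x∈p (Fin.suc-injective ∘ only ∘ there)

containing : (Fin k → Subset n) → Fin n → Subset k
containing F x = tabulate (λ i → lookup (F i) x)

∈-∩containing⁻ : (I : Subset k) (F : Fin k → Subset n) {x : Fin n} {i : Fin k} →
                 i ∈ I ∩ containing F x → i ∈ I × x ∈ F i
∈-∩containing⁻ I F {x} {i} i∈ = let i∈I , i∈Fx = x∈p∩q⁻ I (containing F x) i∈ in
  i∈I , lookup⇒[]= x (F i) (∈-tabulate⁻ i∈Fx)

∑∈-swap : (I : Subset k) (F : Fin k → Subset n) (g : Fin k → Fin n → ℕ) →
          ∑[ i ∈ I ] ∑[ x ∈ F i ] g i x ≡ ∑[ x < n ] ∑[ i ∈ I ∩ containing F x ] g i x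
∑∈-swap {k} {n} I F g = begin
  ∑[ i ∈ I ] ∑[ x ∈ F i ] g i x                  ≡⟨ sum-cong-≗ (λ i → mask-inside (lookup I i)) ⟩
  ∑[ i < k ] ∑[ x < n ] term i x                 ≡⟨ ∑-comm term ⟩
  ∑[ x < n ] ∑[ i < k ] term i x                 ≡⟨ sum-cong-≗ (sum-cong-≗ ∘ unmask) ⟨
  ∑[ x < n ] ∑[ i ∈ I ∩ containing F x ] g i x  ∎
  where
  open ≡-Reasoning
  term : Fin k → Fin n → ℕ
  term i x = if lookup I i ∧ lookup (F i) x then g i x else 0
  mask-inside : ∀ {i} b → (if b then ∑[ x ∈ F i ] g i x else 0) ≡
                          ∑[ x < n ] (if b ∧ lookup (F i) x then g i x else 0)
  mask-inside true  = refl
  mask-inside false = sym (sum-replicate-zero n)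
  lookup-∩ : ∀ x i → lookup (I ∩ containing F x) i ≡ lookup I i ∧ lookup (F i) x
  lookup-∩ x i = trans (lookup-zipWith _∧_ i I (containing F x)) (cong (lookup I i ∧_) (lookup∘tabulate _ i))
  unmask : ∀ x i → (if lookup (I ∩ containing F x) i then g i x else 0) ≡ term i x
  unmask x i = cong (λ b → if b then g i x else 0) (lookup-∩ x i)

∣p∣≡1+∣p-x∣ : {p : Subset n} {x : Fin n} → x ∈ p → ∣ p ∣ ≡ suc ∣ p - x ∣
∣p∣≡1+∣p-x∣ {p = inside ∷ p}  here        = cong (suc ∘ ∣_∣) (sym (p─⊥≡p p))
∣p∣≡1+∣p-x∣ {p = inside ∷ p}  (there x∈p) = cong suc (∣p∣≡1+∣p-x∣ x∈p)
∣p∣≡1+∣p-x∣ {p = outside ∷ p} (there x∈p) = ∣p∣≡1+∣p-x∣ x∈p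

∣p∣≡0⇒p⊆q : {p q : Subset n} → ∣ p ∣ ≡ 0 → p ⊆ q
∣p∣≡0⇒p⊆q ∣p∣≡0 x∈p = case trans (sym ∣p∣≡0) (∣p∣≡1+∣p-x∣ x∈p) of λ ()

x∉p-x : {p : Subset n} {x : Fin n} → x ∉ p - x
x∉p-x {p = _ ∷ p} {suc x} (there x∈p-x) = x∉p-x {p = p} x∈p-x

p⊆q⇒p-x⊆q-x : {p q : Subset n} {x : Fin n} → p ⊆ q → p - x ⊆ q - x
p⊆q⇒p-x⊆q-x {p = p} {q} {x} p⊆q {y} y∈p-x =
  x∈p∧x≢y⇒x∈p-y (p⊆q (p─q⊆p p ⁅ x ⁆ y∈p-x)) λ { refl → x∉p-x y∈p-x }

p-x⊆q-x⇒p⊆q : {p q : Subset n} {x : Fin n} → x ∈ q → p - x ⊆ q - x → p ⊆ q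
p-x⊆q-x⇒p⊆q {q = q} {x} x∈q p-x⊆q-x {y} y∈p with y ≟ x
... | yes refl = x∈q
... | no  y≢x  = p─q⊆p q ⁅ x ⁆ (p-x⊆q-x (x∈p∧x≢y⇒x∈p-y y∈p y≢x))

-- Fibres and images of maps between finite sets

fibre : (Fin m → Fin k) → Fin k → Subset m
fibre c j = subset (λ i → c i ≟ j)

image : (Fin m → Fin k) → Subset k
image c = subset (λ j → any? (λ i → c i ≟ j))

preimage : (Fin m → Fin k) → Subset k → Subset m
preimage c Q = tabulate (lookup Q ∘ c)

∈-preimage⁺ : (c : Fin m → Fin k) (Q : Subset k) {i : Fin m} → c i ∈ Q → i ∈ preimage c Q
∈-preimage⁺ c Q ci∈Q = ∈-tabulate⁺ ([]=⇒lookup ci∈Q)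

∈-preimage⁻ : (c : Fin m → Fin k) (Q : Subset k) {i : Fin m} → i ∈ preimage c Q → c i ∈ Q
∈-preimage⁻ c Q {i} i∈ = lookup⇒[]= (c i) Q (∈-tabulate⁻ i∈)

∑-fibres : (c : Fin m → Fin k) (g : Fin k → ℕ) → ∑[ i < m ] g (c i) ≡ ∑[ j < k ] (∣ fibre c j ∣ * g j)
∑-fibres {zero}  {k} c g = sym (sum-replicate-zero k)
∑-fibres {suc m} {k} c g = begin
  g (c zero) + ∑[ i < m ] g (c (suc i))                   ≡⟨ cong₂ _+_ (sym (∑-point (c zero) g)) (∑-fibres (c ∘ suc) g) ⟩
  ∑[ j < k ] first j + ∑[ j < k ] rest j                  ≡⟨ ∑-distrib-+ first rest ⟨
  ∑[ j < k ] (first j + rest j)                           ≡⟨ sum-cong-≗ peel ⟩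
  ∑[ j < k ] (∣ fibre c j ∣ * g j)                         ∎
  where
  open ≡-Reasoning
  first rest : Fin k → ℕ
  first j = if does (c zero ≟ j) then g j else 0
  rest  j = ∣ fibre (c ∘ suc) j ∣ * g j
  peel : ∀ j → first j + rest j ≡ ∣ fibre c j ∣ * g j
  peel j with does (c zero ≟ j)
  ... | true  = refl
  ... | false = refl

∑∣fibre∣≡ : (c : Fin m → Fin k) → ∑[ j < k ] ∣ fibre c j ∣ ≡ m
∑∣fibre∣≡ {m} {k} c = begin
  ∑[ j < k ] ∣ fibre c j ∣        ≡⟨ sum-cong-≗ (λ j → *-identityʳ ∣ fibre c j ∣) ⟨
  ∑[ j < k ] (∣ fibre c j ∣ * 1)  ≡⟨ ∑-fibres c (λ _ → 1) ⟨
  ∑[ i < m ] 1                    ≡⟨ ∑-const m 1 ⟩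
  m * 1                           ≡⟨ *-identityʳ m ⟩
  m                               ∎
  where open ≡-Reasoning

∣image∩Q∣≤∣preimage∣ : (c : Fin m → Fin k) (Q : Subset k) → ∣ image c ∩ Q ∣ ≤ ∣ preimage c Q ∣
∣image∩Q∣≤∣preimage∣ {m} {k} c Q = begin
  ∣ image c ∩ Q ∣                                             ≡⟨ ∣p∣≡∑ (image c ∩ Q) ⟩
  ∑[ j < k ] (if lookup (image c ∩ Q) j then 1 else 0)       ≤⟨ sum-mono hit ⟩
  ∑[ j < k ] (∣ fibre c j ∣ * (if lookup Q j then 1 else 0))  ≡⟨ ∑-fibres c _ ⟨
  ∑[ i < m ] (if lookup Q (c i) then 1 else 0)               ≡⟨ sum-cong-≗ lookup-preimage ⟨
  ∑[ i < m ] (if lookup (preimage c Q) i then 1 else 0)      ≡⟨ ∣p∣≡∑ (preimage c Q) ⟨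
  ∣ preimage c Q ∣                                            ∎
  where
  open ≤-Reasoning
  lookup-preimage : ∀ i → (if lookup (preimage c Q) i then 1 else 0) ≡ (if lookup Q (c i) then 1 else 0)
  lookup-preimage i = cong (λ b → if b then 1 else 0) (lookup∘tabulate (lookup Q ∘ c) i)
  hit : ∀ j → (if lookup (image c ∩ Q) j then 1 else 0) ≤ ∣ fibre c j ∣ * (if lookup Q j then 1 else 0)
  hit j rewrite lookup-zipWith _∧_ j (image c) Q with lookup (image c) j in j∈image | lookup Q j
  ... | false | _     = z≤n
  ... | true  | false = z≤n
  ... | true  | true  =
    let i , ci≡j = ∈-subset⁻ (λ j → any? (λ i → c i ≟ j)) (lookup⇒[]= j (image c) j∈image) in
    subst (1 ≤_) (trans (sym (∣p∣≡1+∣p-x∣ (∈-subset⁺ (λ i → c i ≟ j) ci≡j))) (sym (*-identityʳ _))) (s≤s z≤n)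

-- Sperner's theorem

unimodal-min : (g : ℕ → ℕ) {h m : ℕ} →
               (∀ {k} → suc k ≤ h → g (suc k) ≤ g k) →
               (∀ {k} → h ≤ k → k < m → g k ≤ g (suc k)) →
               ∀ {k} → k ≤ m → g h ≤ g k
unimodal-min g {h} {m} down up {k} k≤m with ≤-total k h
... | inj₁ k≤h = descend (≤⇒≤‴ k≤h)
  where
  descend : ∀ {k} → k ≤‴ h → g h ≤ g k
  descend ≤‴-refl         = ≤-refl
  descend (≤‴-step 1+k≤h) = ≤-trans (descend 1+k≤h) (down (≤‴⇒≤ 1+k≤h))
... | inj₂ h≤k = ascend (≤⇒≤′ h≤k) k≤m
  where
  ascend : ∀ {k} → h ≤′ k → k ≤ m → g h ≤ g k
  ascend ≤′-refl       _     = ≤-refl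
  ascend (≤′-step h≤k) 1+k≤m = ≤-trans (ascend h≤k (<⇒≤ 1+k≤m)) (up (≤′⇒≤ h≤k) 1+k≤m)

⌊n/2⌋+⌊n/2⌋≤n : ∀ n → ⌊ n /2⌋ + ⌊ n /2⌋ ≤ n
⌊n/2⌋+⌊n/2⌋≤n n = subst (⌊ n /2⌋ + ⌊ n /2⌋ ≤_) (⌊n/2⌋+⌈n/2⌉≡n n) (+-monoʳ-≤ ⌊ n /2⌋ (⌊n/2⌋≤⌈n/2⌉ n))

n≤1+⌊n/2⌋+⌊n/2⌋ : ∀ n → n ≤ suc (⌊ n /2⌋ + ⌊ n /2⌋)
n≤1+⌊n/2⌋+⌊n/2⌋ n = begin
  n                        ≡⟨ ⌊n/2⌋+⌈n/2⌉≡n n ⟨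
  ⌊ n /2⌋ + ⌈ n /2⌉        ≤⟨ +-monoʳ-≤ ⌊ n /2⌋ (⌊n/2⌋-mono (n≤1+n (suc n))) ⟩
  ⌊ n /2⌋ + suc ⌊ n /2⌋    ≡⟨ +-suc ⌊ n /2⌋ ⌊ n /2⌋ ⟩
  suc (⌊ n /2⌋ + ⌊ n /2⌋)  ∎
  where open ≤-Reasoning

-- The number of maximal chains of subsets of an m-set that pass through a fixed k-set.
chainsThrough : ℕ → ℕ → ℕ
chainsThrough m k = k ! * (m ∸ k) !

chainsThrough≢0 : ∀ m k → NonZero (chainsThrough m k)
chainsThrough≢0 m k = m*n≢0 (k !) ((m ∸ k) !) {{k !≢0}} {{(m ∸ k) !≢0}}

chainsThrough-zero : ∀ m → chainsThrough m 0 ≡ m !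
chainsThrough-zero m = +-identityʳ (m !)

chainsThrough-suc : ∀ m k → chainsThrough (suc m) (suc k) ≡ suc k * chainsThrough m k
chainsThrough-suc m k = *-assoc (suc k) (k !) ((m ∸ k) !)

m!≡mCk*chainsThrough : k ≤ m → m ! ≡ (m C k) * chainsThrough m k
m!≡mCk*chainsThrough {k} {m} k≤m = begin
  m !            ≡⟨ m*[n/m]≡n (k![n∸k]!∣n! k≤m) ⟨
  c * (m ! / c)  ≡⟨ cong (c *_) (nCk≡n!/k![n-k]! k≤m) ⟨
  c * (m C k)    ≡⟨ *-comm c (m C k) ⟩
  (m C k) * c    ∎
  where
  open ≡-Reasoning
  c = chainsThrough m k
  instance _ = chainsThrough≢0 m k

chainsThrough-min : ∀ {m k} → k ≤ m → chainsThrough m ⌊ m /2⌋ ≤ chainsThrough m k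
chainsThrough-min {m} = unimodal-min (chainsThrough m) down up
  where
  h = ⌊ m /2⌋
  ratio : ∀ {k} → k < m → (m ∸ k) * chainsThrough m (suc k) ≡ suc k * chainsThrough m k
  ratio = [n-k]*d[k+1]≡[k+1]*d[k]

  down : ∀ {k} → suc k ≤ h → chainsThrough m (suc k) ≤ chainsThrough m k
  down {k} 1+k≤h = *-cancelˡ-≤ (m ∸ k) {{>-nonZero (m<n⇒0<n∸m k<m)}} (begin
    (m ∸ k) * chainsThrough m (suc k)  ≡⟨ ratio k<m ⟩
    suc k * chainsThrough m k          ≤⟨ *-monoˡ-≤ _ (m+n≤o⇒m≤o∸n (suc k) 1+k+k≤m) ⟩
    (m ∸ k) * chainsThrough m k        ∎)
    where
    open ≤-Reasoning
    1+k+k≤m : suc k + k ≤ m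
    1+k+k≤m = ≤-trans (+-mono-≤ 1+k≤h (<⇒≤ 1+k≤h)) (⌊n/2⌋+⌊n/2⌋≤n m)
    k<m : k < m
    k<m = ≤-trans (m≤m+n (suc k) k) 1+k+k≤m

  up : ∀ {k} → h ≤ k → k < m → chainsThrough m k ≤ chainsThrough m (suc k)
  up {k} h≤k k<m = *-cancelˡ-≤ (suc k) (begin
    suc k * chainsThrough m k          ≡⟨ ratio k<m ⟨
    (m ∸ k) * chainsThrough m (suc k)  ≤⟨ *-monoˡ-≤ _ (m≤n+o⇒m∸n≤o m k m≤k+1+k) ⟩
    suc k * chainsThrough m (suc k)    ∎)
    where
    open ≤-Reasoning
    m≤k+1+k : m ≤ k + suc k
    m≤k+1+k = begin
      m            ≤⟨ n≤1+⌊n/2⌋+⌊n/2⌋ m ⟩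
      suc (h + h)  ≤⟨ s≤s (+-mono-≤ h≤k h≤k) ⟩
      suc (k + k)  ≡⟨ +-suc k k ⟨
      k + suc k    ∎

chainsThrough-split : ∀ m (A : Subset n) → ∣ A ∣ ≢ 0 →
                      chainsThrough (suc m) ∣ A ∣ ≡ ∑[ x ∈ A ] chainsThrough m ∣ A - x ∣
chainsThrough-split m A ∣A∣≢0 with ∣ A ∣ in ∣A∣≡
... | zero  = contradiction refl ∣A∣≢0
... | suc k = begin
  chainsThrough (suc m) (suc k)         ≡⟨ chainsThrough-suc m k ⟩
  suc k * chainsThrough m k             ≡⟨ cong (_* chainsThrough m k) ∣A∣≡ ⟨
  ∣ A ∣ * chainsThrough m k             ≡⟨ ∑∈-const A (chainsThrough m k) ⟨
  ∑[ x ∈ A ] chainsThrough m k          ≡⟨ ∑∈-cong A (cong (chainsThrough m) ∘ ∣A-x∣≡k) ⟩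
  ∑[ x ∈ A ] chainsThrough m ∣ A - x ∣  ∎
  where
  open ≡-Reasoning
  ∣A-x∣≡k : ∀ {x} → x ∈ A → k ≡ ∣ A - x ∣
  ∣A-x∣≡k x∈A = suc-injective (trans (sym ∣A∣≡) (∣p∣≡1+∣p-x∣ x∈A))

Antichain : Subset k → (Fin k → Subset n) → Set
Antichain I F = ∀ {i j} → i ∈ I → j ∈ I → F i ⊆ F j → i ≡ j

lym : ∀ m {U : Subset n} {I : Subset k} {F : Fin k → Subset n} → ∣ U ∣ ≡ m →
      (∀ {i} → i ∈ I → F i ⊆ U) → Antichain I F →
      ∑[ i ∈ I ] chainsThrough m ∣ F i ∣ ≤ m !
lym m {U} {I} {F} ∣U∣≡m F⊆U anti with any? (λ i → i ∈? I ×-dec ∣ F i ∣ ℕ.≟ 0)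
... | yes (i , i∈I , ∣Fi∣≡0) = ≤-reflexive (begin
  ∑[ j ∈ I ] chainsThrough m ∣ F j ∣  ≡⟨ ∑∈-single I _ i∈I (λ j∈I → sym (anti i∈I j∈I (∣p∣≡0⇒p⊆q ∣Fi∣≡0))) ⟩
  chainsThrough m ∣ F i ∣             ≡⟨ cong (chainsThrough m) ∣Fi∣≡0 ⟩
  chainsThrough m 0                   ≡⟨ chainsThrough-zero m ⟩
  m !                                 ∎)
  where open ≡-Reasoning
lym zero {I = I} ∣U∣≡0 F⊆U _ | no ∄empty = ≤-trans (≤-reflexive (∑∈-empty I _ no-member)) z≤n
  where
  no-member : ∀ {i} → i ∉ I
  no-member i∈I = ∄empty (_ , i∈I , n≤0⇒n≡0 (subst (_ ≤_) ∣U∣≡0 (p⊆q⇒∣p∣≤∣q∣ (F⊆U i∈I))))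
lym (suc m) {U} {I} {F} ∣U∣≡1+m F⊆U anti | no ∄empty = begin
  ∑[ i ∈ I ] chainsThrough (suc m) ∣ F i ∣                            ≡⟨ ∑∈-cong I split ⟩
  ∑[ i ∈ I ] ∑[ x ∈ F i ] chainsThrough m ∣ F i - x ∣                 ≡⟨ ∑∈-swap I F _ ⟩
  ∑[ x < _ ] ∑[ i ∈ I ∩ containing F x ] chainsThrough m ∣ F i - x ∣  ≤⟨ sum-mono inner≤ ⟩
  ∑[ x ∈ U ] (m !)                                                    ≡⟨ ∑∈-const U (m !) ⟩
  ∣ U ∣ * m !                                                         ≡⟨ cong (_* m !) ∣U∣≡1+m ⟩
  suc m !                                                             ∎
  where
  open ≤-Reasoning
  split : ∀ {i} → i ∈ I → chainsThrough (suc m) ∣ F i ∣ ≡ ∑[ x ∈ F i ] chainsThrough m ∣ F i - x ∣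
  split {i} i∈I = chainsThrough-split m (F i) (λ ∣Fi∣≡0 → ∄empty (i , i∈I , ∣Fi∣≡0))

  inner≤ : ∀ x → ∑[ i ∈ I ∩ containing F x ] chainsThrough m ∣ F i - x ∣ ≤ (if lookup U x then m ! else 0)
  inner≤ x with lookup U x in x∈U?
  ... | true  = lym m ∣U-x∣≡m (p⊆q⇒p-x⊆q-x ∘ F⊆U ∘ ∈I) anti-x
    where
    ∣U-x∣≡m : ∣ U - x ∣ ≡ m
    ∣U-x∣≡m = suc-injective (trans (sym (∣p∣≡1+∣p-x∣ (lookup⇒[]= x U x∈U?))) ∣U∣≡1+m)
    ∈I : ∀ {i} → i ∈ I ∩ containing F x → i ∈ I
    ∈I = proj₁ ∘ ∈-∩containing⁻ I F
    anti-x : Antichain (I ∩ containing F x) (λ i → F i - x)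
    anti-x i∈ j∈ = anti (∈I i∈) (∈I j∈) ∘ p-x⊆q-x⇒p⊆q (proj₂ (∈-∩containing⁻ I F j∈))
  ... | false = ≤-reflexive (∑∈-empty _ _ λ i∈ → let i∈I , x∈Fi = ∈-∩containing⁻ I F i∈ in
    case trans (sym ([]=⇒lookup (F⊆U i∈I x∈Fi))) x∈U? of λ ())

sperner : (U : Subset n) {I : Subset k} {F : Fin k → Subset n} →
          (∀ {i} → i ∈ I → F i ⊆ U) → Antichain I F → ∣ I ∣ ≤ ∣ U ∣ C ⌊ ∣ U ∣ /2⌋
sperner U {I} {F} F⊆U anti = *-cancelʳ-≤ ∣ I ∣ (u C h) (chainsThrough u h) {{chainsThrough≢0 u h}} (begin
  ∣ I ∣ * chainsThrough u h           ≡⟨ ∑∈-const I (chainsThrough u h) ⟨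
  ∑[ i ∈ I ] chainsThrough u h        ≤⟨ ∑∈-mono I (chainsThrough-min ∘ p⊆q⇒∣p∣≤∣q∣ ∘ F⊆U) ⟩
  ∑[ i ∈ I ] chainsThrough u ∣ F i ∣  ≤⟨ lym u refl F⊆U anti ⟩
  u !                                 ≡⟨ m!≡mCk*chainsThrough (⌊n/2⌋≤n u) ⟩
  (u C h) * chainsThrough u h         ∎)
  where
  open ≤-Reasoning
  u = ∣ U ∣
  h = ⌊ u /2⌋

middleBinomial : ℕ → ℕ
middleBinomial n = n C ⌊ n /2⌋

nCk≤[1+n]Ck : ∀ n k → n C k ≤ suc n C k
nCk≤[1+n]Ck n zero    = ≤-refl
nCk≤[1+n]Ck n (suc k) = subst (n C suc k ≤_) (nCk+nC[k+1]≡[n+1]C[k+1] n k) (m≤n+m _ _)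

nCk≤[1+n]C[1+k] : ∀ n k → n C k ≤ suc n C suc k
nCk≤[1+n]C[1+k] n k = subst (n C k ≤_) (nCk+nC[k+1]≡[n+1]C[k+1] n k) (m≤m+n _ _)

⌊1+n/2⌋≡ : ∀ n → ⌊ suc n /2⌋ ≡ ⌊ n /2⌋ ⊎ ⌊ suc n /2⌋ ≡ suc ⌊ n /2⌋
⌊1+n/2⌋≡ zero          = inj₁ refl
⌊1+n/2⌋≡ (suc zero)    = inj₂ refl
⌊1+n/2⌋≡ (suc (suc n)) = Sum.map (cong suc) (cong suc) (⌊1+n/2⌋≡ n)

middleBinomial-suc : ∀ n → middleBinomial n ≤ middleBinomial (suc n)
middleBinomial-suc n with ⌊ suc n /2⌋ | ⌊1+n/2⌋≡ n
... | _ | inj₁ refl = nCk≤[1+n]Ck n ⌊ n /2⌋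
... | _ | inj₂ refl = nCk≤[1+n]C[1+k] n ⌊ n /2⌋

middleBinomial-mono : m ≤ n → middleBinomial m ≤ middleBinomial n
middleBinomial-mono = mono′ ∘ ≤⇒≤′
  where
  mono′ : m ≤′ n → middleBinomial m ≤ middleBinomial n
  mono′ ≤′-refl                   = ≤-refl
  mono′ {n = suc n} (≤′-step m≤n) = ≤-trans (mono′ m≤n) (middleBinomial-suc n)

2*middleBinomial≤ : ∀ n → 2 * middleBinomial n ≤ middleBinomial (2 + n)
2*middleBinomial≤ n = begin
  2 * middleBinomial n       ≡⟨ cong (middleBinomial n +_) (+-identityʳ _) ⟩
  n C h + n C h              ≤⟨ +-mono-≤ (nCk≤[1+n]Ck n h) (nCk≤[1+n]C[1+k] n h) ⟩
  suc n C h + suc n C suc h  ≡⟨ nCk+nC[k+1]≡[n+1]C[k+1] (suc n) h ⟩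
  middleBinomial (2 + n)     ∎
  where
  open ≤-Reasoning
  h = ⌊ n /2⌋

-- Orientations of K(3,p,q) in which all distances are at most two

walk≤2 : ∀ {p q} (D : Orientation p q) {u v} → DistLe D 2 u v →
         u ≡ v ⊎ Arc D u v ⊎ ∃[ w ] (Arc D u w × Arc D w v)
walk≤2 D (0 , _ , here)                         = inj₁ refl
walk≤2 D (1 , _ , step u→v here)                = inj₂ (inj₁ u→v)
walk≤2 D (2 , _ , step u→w (step w→v here))     = inj₂ (inj₂ (_ , u→w , w→v))
walk≤2 D (suc (suc (suc _)) , s≤s (s≤s ()) , _)

typeAt : Fin 8 → Subset 3
typeAt 0F = inside  ∷ inside  ∷ inside  ∷ []
typeAt 1F = inside  ∷ inside  ∷ outside ∷ []
typeAt 2F = inside  ∷ outside ∷ inside  ∷ []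
typeAt 3F = inside  ∷ outside ∷ outside ∷ []
typeAt 4F = outside ∷ inside  ∷ inside  ∷ []
typeAt 5F = outside ∷ inside  ∷ outside ∷ []
typeAt 6F = outside ∷ outside ∷ inside  ∷ []
typeAt 7F = outside ∷ outside ∷ outside ∷ []

typeIndex : Subset 3 → Fin 8
typeIndex (inside  ∷ inside  ∷ inside  ∷ []) = 0F
typeIndex (inside  ∷ inside  ∷ outside ∷ []) = 1F
typeIndex (inside  ∷ outside ∷ inside  ∷ []) = 2F
typeIndex (inside  ∷ outside ∷ outside ∷ []) = 3F
typeIndex (outside ∷ inside  ∷ inside  ∷ []) = 4F
typeIndex (outside ∷ inside  ∷ outside ∷ []) = 5F
typeIndex (outside ∷ outside ∷ inside  ∷ []) = 6F
typeIndex (outside ∷ outside ∷ outside ∷ []) = 7F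

typeAt∘typeIndex : ∀ S → typeAt (typeIndex S) ≡ S
typeAt∘typeIndex (inside  ∷ inside  ∷ inside  ∷ []) = refl
typeAt∘typeIndex (inside  ∷ inside  ∷ outside ∷ []) = refl
typeAt∘typeIndex (inside  ∷ outside ∷ inside  ∷ []) = refl
typeAt∘typeIndex (inside  ∷ outside ∷ outside ∷ []) = refl
typeAt∘typeIndex (outside ∷ inside  ∷ inside  ∷ []) = refl
typeAt∘typeIndex (outside ∷ inside  ∷ outside ∷ []) = refl
typeAt∘typeIndex (outside ∷ outside ∷ inside  ∷ []) = refl
typeAt∘typeIndex (outside ∷ outside ∷ outside ∷ []) = refl

typeIndex∘typeAt : ∀ a → typeIndex (typeAt a) ≡ a
typeIndex∘typeAt 0F = refl
typeIndex∘typeAt 1F = refl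
typeIndex∘typeAt 2F = refl
typeIndex∘typeAt 3F = refl
typeIndex∘typeAt 4F = refl
typeIndex∘typeAt 5F = refl
typeIndex∘typeAt 6F = refl
typeIndex∘typeAt 7F = refl

Comparable : Subset n → Subset n → Set
Comparable A B = A ⊆ B ⊎ B ⊆ A

comparable? : (A B : Subset n) → Dec (Comparable A B)
comparable? A B = A ⊆? B ⊎-dec B ⊆? A

comparableTo : Subset 3 → Subset 8
comparableTo S = subset (λ a → comparable? (typeAt a) S)

capped : ℕ → Fin 4
capped k = fromℕ< (s≤s (m⊓n≤n k 3))

toℕ-capped≤ : ∀ k → toℕ (capped k) ≤ k
toℕ-capped≤ k = subst (_≤ k) (sym (toℕ-fromℕ< _)) (m⊓n≤m k 3)

-- For the set β of types present in V₂, the level of type a encodes the bound on the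
-- number of vertices of V₃ of type a proved below: 0F if a ∈ β (no such vertex), 1F if
-- every type in β is comparable with a (at most one), and otherwise 2 + k, where k is
-- the number of types in β comparable with a, capped at 3 (at most C(p−k, ⌊(p−k)/2⌋)).
level : Subset 8 → Fin 8 → Fin 6
level β a with a ∈? β | β ⊆? comparableTo (typeAt a)
... | yes _ | _     = 0F
... | no  _ | yes _ = 1F
... | no  _ | no  _ = suc (suc (capped ∣ β ∩ comparableTo (typeAt a) ∣))

levelBound : ℕ → Fin 6 → ℕ
levelBound p 0F            = 0
levelBound p 1F            = 1
levelBound p (suc (suc k)) = middleBinomial (p ∸ toℕ k)

module AllDistances≤2 {p q : ℕ} (D : Orientation p q) (dist≤2 : ∀ u v → DistLe D 2 u v) where
  open Orientation D

  inNbr₂ : Fin p → Subset 3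
  inNbr₂ v = tabulate (λ i → o12 i v)

  inNbr₃ : Fin q → Subset 3
  inNbr₃ w = tabulate (λ i → o13 i w)

  ∈-inNbr₂⁺ : ∀ {i v} → Arc D (v₁ i) (v₂ v) → i ∈ inNbr₂ v
  ∈-inNbr₂⁺ {v = v} = ∈-tabulate⁺ {f = λ i → o12 i v}

  ∈-inNbr₂⁻ : ∀ {i v} → i ∈ inNbr₂ v → Arc D (v₁ i) (v₂ v)
  ∈-inNbr₂⁻ {v = v} = ∈-tabulate⁻ {f = λ i → o12 i v}

  ∈-inNbr₃⁺ : ∀ {i w} → Arc D (v₁ i) (v₃ w) → i ∈ inNbr₃ w
  ∈-inNbr₃⁺ {w = w} = ∈-tabulate⁺ {f = λ i → o13 i w}

  ∈-inNbr₃⁻ : ∀ {i w} → i ∈ inNbr₃ w → Arc D (v₁ i) (v₃ w)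
  ∈-inNbr₃⁻ {w = w} = ∈-tabulate⁻ {f = λ i → o13 i w}

  no-2-cycle : ∀ {v w} → Arc D (v₂ v) (v₃ w) → ¬ Arc D (v₃ w) (v₂ v)
  no-2-cycle v→w w→v = case trans (sym v→w) w→v of λ ()

  forced-w→v : ∀ {v w} → inNbr₂ v ⊆ inNbr₃ w → Arc D (v₃ w) (v₂ v)
  forced-w→v {v} {w} N₂⊆N₃ with o23 v w in v→w
  ... | false = refl
  ... | true with walk≤2 D (dist≤2 (v₃ w) (v₂ v))
  ... | inj₂ (inj₁ w→v)                   = contradiction w→v (no-2-cycle v→w)
  ... | inj₂ (inj₂ (v₁ i , w→xᵢ , xᵢ→v)) = case trans (sym (∈-inNbr₃⁻ (N₂⊆N₃ (∈-inNbr₂⁺ xᵢ→v)))) w→xᵢ of λ ()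
  ... | inj₂ (inj₂ (v₂ _ , _ , ()))
  ... | inj₂ (inj₂ (v₃ _ , () , _))

  forced-v→w : ∀ {v w} → inNbr₃ w ⊆ inNbr₂ v → Arc D (v₂ v) (v₃ w)
  forced-v→w {v} {w} N₃⊆N₂ with o23 v w in v→w
  ... | true = refl
  ... | false with walk≤2 D (dist≤2 (v₂ v) (v₃ w))
  ... | inj₂ (inj₁ v→w′)                  = case trans (sym v→w) v→w′ of λ ()
  ... | inj₂ (inj₂ (v₁ i , v→xᵢ , xᵢ→w)) = case trans (sym (∈-inNbr₂⁻ (N₃⊆N₂ (∈-inNbr₃⁺ xᵢ→w)))) v→xᵢ of λ ()
  ... | inj₂ (inj₂ (v₂ _ , () , _))
  ... | inj₂ (inj₂ (v₃ _ , _ , ()))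

  separated : ∀ {w₁ w₂} → inNbr₃ w₁ ≡ inNbr₃ w₂ → w₁ ≢ w₂ →
              ∃[ v ] (Arc D (v₃ w₁) (v₂ v) × Arc D (v₂ v) (v₃ w₂))
  separated {w₁} {w₂} N₁≡N₂ w₁≢w₂ with walk≤2 D (dist≤2 (v₃ w₁) (v₃ w₂))
  ... | inj₁ refl                            = contradiction refl w₁≢w₂
  ... | inj₂ (inj₂ (v₁ i , w₁→xᵢ , xᵢ→w₂)) =
    case trans (sym w₁→xᵢ) (∈-inNbr₃⁻ (subst (i ∈_) (sym N₁≡N₂) (∈-inNbr₃⁺ xᵢ→w₂))) of λ ()
  ... | inj₂ (inj₂ (v₂ v , w₁→v , v→w₂))   = v , w₁→v , v→w₂
  ... | inj₂ (inj₂ (v₃ _ , () , _))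

  τ : Fin p → Fin 8
  τ v = typeIndex (inNbr₂ v)

  σ : Fin q → Fin 8
  σ w = typeIndex (inNbr₃ w)

  inNbr₂-τ : ∀ {v a} → τ v ≡ a → inNbr₂ v ≡ typeAt a
  inNbr₂-τ {v} refl = sym (typeAt∘typeIndex (inNbr₂ v))

  inNbr₃-σ : ∀ {w a} → w ∈ fibre σ a → inNbr₃ w ≡ typeAt a
  inNbr₃-σ {w} w∈ = trans (sym (typeAt∘typeIndex (inNbr₃ w))) (cong typeAt (∈-subset⁻ (λ w → σ w ≟ _) w∈))

  free : Subset 3 → Subset p
  free S = ∁ (preimage τ (comparableTo S))

  outFree : Subset 3 → Fin q → Subset p
  outFree S w = free S ∩ subset (λ v → o23 v w Bool.≟ false)

  ∈-free⁺ : ∀ {S v} → ¬ Comparable (inNbr₂ v) S → v ∈ free S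
  ∈-free⁺ {S} {v} incomparable = x∉p⇒x∈∁p λ v∈pre →
    incomparable (subst (λ N → Comparable N S) (typeAt∘typeIndex (inNbr₂ v))
                        (∈-subset⁻ (λ a → comparable? (typeAt a) S) (∈-preimage⁻ τ _ v∈pre)))

  class-antichain : ∀ a → Antichain (fibre σ a) (outFree (typeAt a))
  class-antichain a {w₁} {w₂} w₁∈ w₂∈ out₁⊆out₂ with w₁ ≟ w₂
  ... | yes w₁≡w₂ = w₁≡w₂
  ... | no  w₁≢w₂ = contradiction w₂→v (no-2-cycle v→w₂)
    where
    S = typeAt a
    N₁≡S = inNbr₃-σ w₁∈
    N₂≡S = inNbr₃-σ w₂∈
    separator = separated (trans N₁≡S (sym N₂≡S)) w₁≢w₂
    v    = proj₁ separator
    w₁→v = proj₁ (proj₂ separator)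
    v→w₂ = proj₂ (proj₂ separator)
    v-free : v ∈ free S
    v-free = ∈-free⁺ λ where
      (inj₁ N⊆S) → no-2-cycle v→w₂ (forced-w→v (subst (inNbr₂ v ⊆_) (sym N₂≡S) N⊆S))
      (inj₂ S⊆N) → no-2-cycle (forced-v→w (subst (_⊆ inNbr₂ v) (sym N₁≡S) S⊆N)) w₁→v
    v∈out₂ : v ∈ outFree S w₂
    v∈out₂ = out₁⊆out₂ (x∈p∩q⁺ (v-free , ∈-subset⁺ (λ v → o23 v w₁ Bool.≟ false) w₁→v))
    w₂→v : Arc D (v₃ w₂) (v₂ v)
    w₂→v = ∈-subset⁻ (λ v → o23 v w₂ Bool.≟ false) (proj₂ (x∈p∩q⁻ (free S) _ v∈out₂))

  class-sperner : ∀ a → ∣ fibre σ a ∣ ≤ middleBinomial ∣ free (typeAt a) ∣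
  class-sperner a = sperner (free (typeAt a)) (λ _ → p∩q⊆p _ _) (class-antichain a)

  class-empty : ∀ {a} → a ∈ image τ → ∣ fibre σ a ∣ ≡ 0
  class-empty {a} a∈image = Empty⇒∣p∣≡0 λ (w , w∈) →
    let N₃≡N₂ = trans (inNbr₃-σ w∈) (sym N₂≡S) in
    no-2-cycle (forced-v→w (⊆-reflexive N₃≡N₂)) (forced-w→v (⊆-reflexive (sym N₃≡N₂)))
    where
    N₂≡S = inNbr₂-τ (proj₂ (∈-subset⁻ (λ a → any? (λ v → τ v ≟ a)) a∈image))

  free-empty : ∀ {S} → image τ ⊆ comparableTo S → ∣ free S ∣ ≡ 0
  free-empty image⊆ = Empty⇒∣p∣≡0 λ (v , v∈free) → x∈∁p⇒x∉p v∈free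
    (∈-preimage⁺ τ _ (image⊆ (∈-subset⁺ (λ a → any? (λ v → τ v ≟ a)) (v , refl))))

  free-size : ∀ S → ∣ free S ∣ + ∣ image τ ∩ comparableTo S ∣ ≤ p
  free-size S = begin
    ∣ free S ∣ + ∣ image τ ∩ comparableTo S ∣  ≤⟨ +-monoʳ-≤ ∣ free S ∣ (∣image∩Q∣≤∣preimage∣ τ (comparableTo S)) ⟩
    ∣ ∁ pre ∣ + ∣ pre ∣                        ≡⟨ cong (_+ ∣ pre ∣) (∣∁p∣≡n∸∣p∣ pre) ⟩
    (p ∸ ∣ pre ∣) + ∣ pre ∣                    ≡⟨ m∸n+n≡m (∣p∣≤n pre) ⟩
    p                                          ∎
    where
    open ≤-Reasoning
    pre = preimage τ (comparableTo S)

  class-bound : ∀ a → ∣ fibre σ a ∣ ≤ levelBound p (level (image τ) a)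
  class-bound a with a ∈? image τ | image τ ⊆? comparableTo (typeAt a)
  ... | yes a∈image | _          = ≤-reflexive (class-empty a∈image)
  ... | no  _       | yes image⊆ =
    subst (λ f → ∣ fibre σ a ∣ ≤ middleBinomial f) (free-empty {typeAt a} image⊆) (class-sperner a)
  ... | no  _       | no  _      = ≤-trans (class-sperner a) (middleBinomial-mono (begin
    ∣ free S ∣          ≤⟨ m+n≤o⇒m≤o∸n ∣ free S ∣ (free-size S) ⟩
    p ∸ c               ≤⟨ ∸-monoʳ-≤ p (toℕ-capped≤ c) ⟩
    p ∸ toℕ (capped c)  ∎))
    where
    open ≤-Reasoning
    S = typeAt a
    c = ∣ image τ ∩ comparableTo S ∣

  q≤levelSum : q ≤ ∑[ j < 6 ] (∣ fibre (level (image τ)) j ∣ * levelBound p j)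
  q≤levelSum = begin
    q                                                            ≡⟨ ∑∣fibre∣≡ σ ⟨
    ∑[ a < 8 ] ∣ fibre σ a ∣                                     ≤⟨ sum-mono class-bound ⟩
    ∑[ a < 8 ] levelBound p (level (image τ) a)                  ≡⟨ ∑-fibres (level (image τ)) (levelBound p) ⟩
    ∑[ j < 6 ] (∣ fibre (level (image τ)) j ∣ * levelBound p j)  ∎
    where open ≤-Reasoning

  nonempty? : ∀ A → Dec (∃[ v ] InV₂ D A v)
  nonempty? A = any? (λ v → all? (λ i → o12 i v Bool.≟ lookup A i))

  nonempty⇔ : ∀ a → (∃[ v ] InV₂ D (typeAt a) v) ⇔ (∃[ v ] τ v ≡ a)
  nonempty⇔ a = mk⇔ to from
    where
    to : ∃[ v ] InV₂ D (typeAt a) v → ∃[ v ] τ v ≡ a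
    to (v , o12≡) = v , (begin
      typeIndex (inNbr₂ v)                      ≡⟨ cong typeIndex (tabulate-cong o12≡) ⟩
      typeIndex (tabulate (lookup (typeAt a)))  ≡⟨ cong typeIndex (tabulate∘lookup (typeAt a)) ⟩
      typeIndex (typeAt a)                      ≡⟨ typeIndex∘typeAt a ⟩
      a                                         ∎)
      where open ≡-Reasoning
    from : ∃[ v ] τ v ≡ a → ∃[ v ] InV₂ D (typeAt a) v
    from (v , τv≡a) = v , λ i →
      trans (sym (lookup∘tabulate (λ i → o12 i v) i)) (cong (λ N → lookup N i) (inNbr₂-τ τv≡a))

  nonemptyV₂Count≡ : nonemptyV₂Count D ≡ ∣ image τ ∣
  nonemptyV₂Count≡ = trans (length-filter-tabulate nonempty? typeAt)
    (cong ∣_∣ (tabulate-cong λ a → does-⇔ (nonempty⇔ a) (nonempty? (typeAt a)) (any? (λ v → τ v ≟ a))))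

-- The eight level profiles

-- a₁, a₂, a₃ stand for the middle binomial coefficients at p − 1, p − 2, p − 3; the
-- left-hand sides are the level sums as they reduce for the eight profiles below.
module ProfileBounds (a₁ a₂ a₃ : ℕ) (a₃≤a₂ : a₃ ≤ a₂) (a₂≤a₁ : a₂ ≤ a₁) (2a₃≤a₁ : 2 * a₃ ≤ a₁) where
  open ≤-Reasoning

  variables : List.List ℕ
  variables = a₁ List.∷ a₂ List.∷ a₃ List.∷ List.[]

  bound : ℕ
  bound = (1 + 2 * a₂ + a₁) ⊔ (2 + 2 * a₁)

  left≤bound : 1 + 2 * a₂ + a₁ ≤ bound
  left≤bound = m≤m⊔n (1 + 2 * a₂ + a₁) (2 + 2 * a₁)

  right≤bound : 2 + 2 * a₁ ≤ bound
  right≤bound = m≤n⊔m (1 + 2 * a₂ + a₁) (2 + 2 * a₁)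

  4a₃≤ : 4 * a₃ + 0 ≤ bound
  4a₃≤ = begin
    4 * a₃ + 0    ≡⟨ solve variables ⟩
    2 * (2 * a₃)  ≤⟨ *-monoʳ-≤ 2 2a₃≤a₁ ⟩
    2 * a₁        ≤⟨ m≤n+m _ 2 ⟩
    2 + 2 * a₁    ≤⟨ right≤bound ⟩
    bound         ∎

  2a₂+2a₃≤ : 2 * a₂ + (2 * a₃ + 0) ≤ bound
  2a₂+2a₃≤ = begin
    2 * a₂ + (2 * a₃ + 0)  ≡⟨ solve variables ⟩
    2 * a₂ + 2 * a₃        ≤⟨ +-monoʳ-≤ (2 * a₂) 2a₃≤a₁ ⟩
    2 * a₂ + a₁            ≤⟨ n≤1+n _ ⟩
    1 + 2 * a₂ + a₁        ≤⟨ left≤bound ⟩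
    bound                  ∎

  1+3a₃≤ : 1 + (3 * a₃ + 0) ≤ bound
  1+3a₃≤ = begin
    1 + (3 * a₃ + 0)  ≡⟨ solve variables ⟩
    1 + a₃ + 2 * a₃   ≤⟨ +-mono-≤ (+-monoʳ-≤ 1 (≤-trans a₃≤a₂ (m≤m+n a₂ _))) 2a₃≤a₁ ⟩
    1 + 2 * a₂ + a₁   ≤⟨ left≤bound ⟩
    bound             ∎

  1+a₂+2a₃≤ : 1 + (1 * a₂ + (2 * a₃ + 0)) ≤ bound
  1+a₂+2a₃≤ = begin
    1 + (1 * a₂ + (2 * a₃ + 0))  ≡⟨ solve variables ⟩
    1 + a₂ + 2 * a₃              ≤⟨ +-mono-≤ (+-monoʳ-≤ 1 (m≤m+n a₂ _)) 2a₃≤a₁ ⟩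
    1 + 2 * a₂ + a₁              ≤⟨ left≤bound ⟩
    bound                        ∎

  1+2a₂+a₃≤ : 1 + (2 * a₂ + (1 * a₃ + 0)) ≤ bound
  1+2a₂+a₃≤ = begin
    1 + (2 * a₂ + (1 * a₃ + 0))  ≡⟨ solve variables ⟩
    1 + 2 * a₂ + a₃              ≤⟨ +-monoʳ-≤ (1 + 2 * a₂) (≤-trans a₃≤a₂ a₂≤a₁) ⟩
    1 + 2 * a₂ + a₁              ≤⟨ left≤bound ⟩
    bound                        ∎

  1+a₁+2a₂≤ : 1 + (1 * a₁ + (2 * a₂ + 0)) ≤ bound
  1+a₁+2a₂≤ = begin
    1 + (1 * a₁ + (2 * a₂ + 0))  ≡⟨ solve variables ⟩
    1 + 2 * a₂ + a₁              ≤⟨ left≤bound ⟩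
    bound                        ∎

  2+2a₂≤ : 2 + (2 * a₂ + 0) ≤ bound
  2+2a₂≤ = begin
    2 + (2 * a₂ + 0)  ≡⟨ solve variables ⟩
    2 + 2 * a₂        ≤⟨ +-monoʳ-≤ 2 (*-monoʳ-≤ 2 a₂≤a₁) ⟩
    2 + 2 * a₁        ≤⟨ right≤bound ⟩
    bound             ∎

  2+2a₁≤ : 2 + (2 * a₁ + 0) ≤ bound
  2+2a₁≤ = begin
    2 + (2 * a₁ + 0)  ≡⟨ solve variables ⟩
    2 + 2 * a₁        ≤⟨ right≤bound ⟩
    bound             ∎

fourTypeBound : ℕ → ℕ
fourTypeBound p = (1 + 2 * middleBinomial (p ∸ 2) + middleBinomial (p ∸ 1)) ⊔ (2 + 2 * middleBinomial (p ∸ 1))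

profile : Subset 8 → Vec ℕ 6
profile β = tabulate (λ j → ∣ fibre (level β) j ∣)

profiles : Vec (Vec ℕ 6) 8
profiles = (4 ∷ 0 ∷ 0 ∷ 0 ∷ 0 ∷ 4 ∷ [])
         ∷ (4 ∷ 0 ∷ 0 ∷ 0 ∷ 2 ∷ 2 ∷ [])
         ∷ (4 ∷ 1 ∷ 0 ∷ 0 ∷ 0 ∷ 3 ∷ [])
         ∷ (4 ∷ 1 ∷ 0 ∷ 0 ∷ 1 ∷ 2 ∷ [])
         ∷ (4 ∷ 1 ∷ 0 ∷ 0 ∷ 2 ∷ 1 ∷ [])
         ∷ (4 ∷ 1 ∷ 0 ∷ 1 ∷ 2 ∷ 0 ∷ [])
         ∷ (4 ∷ 2 ∷ 0 ∷ 0 ∷ 2 ∷ 0 ∷ [])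
         ∷ (4 ∷ 2 ∷ 0 ∷ 2 ∷ 0 ∷ 0 ∷ [])
         ∷ []

-- Proved by evaluating `profile` on all 2⁸ sets of types.
profile∈profiles : ∀ β → ∣ β ∣ ≡ 4 → profile β ∈ᵥ profiles
profile∈profiles β = decidable-stable (check? β) λ ¬ok → no-counterexample (β , ¬ok)
  where
  check? : ∀ β → Dec (∣ β ∣ ≡ 4 → profile β ∈ᵥ profiles)
  check? β = (∣ β ∣ ℕ.≟ 4) →-dec (profile β ∈ᵥ? profiles)
  no-counterexample : ¬ (∃[ β ] ¬ (∣ β ∣ ≡ 4 → profile β ∈ᵥ profiles))
  no-counterexample = from-no (anySubset? (¬? ∘ check?))

profiles-bounded : ∀ n →
  All (λ s → ∑[ j < 6 ] (lookup s j * levelBound (4 + n) j) ≤ fourTypeBound (4 + n)) profiles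
profiles-bounded n =
  4a₃≤ ∷ 2a₂+2a₃≤ ∷ 1+3a₃≤ ∷ 1+a₂+2a₃≤ ∷ 1+2a₂+a₃≤ ∷ 1+a₁+2a₂≤ ∷ 2+2a₂≤ ∷ 2+2a₁≤ ∷ []
  where
  open ProfileBounds (middleBinomial (3 + n)) (middleBinomial (2 + n)) (middleBinomial (1 + n))
         (middleBinomial-suc (1 + n)) (middleBinomial-suc (2 + n)) (2*middleBinomial≤ (1 + n))

levelSum≤ : ∀ n β → ∣ β ∣ ≡ 4 →
            ∑[ j < 6 ] (∣ fibre (level β) j ∣ * levelBound (4 + n) j) ≤ fourTypeBound (4 + n)
levelSum≤ n β ∣β∣≡4 = subst (_≤ fourTypeBound (4 + n))
  (sum-cong-≗ λ j → cong (_* levelBound (4 + n) j) (lookup∘tabulate (λ j → ∣ fibre (level β) j ∣) j))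
  (All.lookup (profiles-bounded n) (profile∈profiles β ∣β∣≡4))

theorem4p16 : (p q : ℕ) → 4 ≤ p → p ≤ q → (D : Orientation p q) →
    Strong D → Diameter2 D → nonemptyV₂Count D ≡ 4 →
    q ≤ ((1 + 2 * ((p ∸ 2) C ⌊ p ∸ 2 /2⌋) + ((p ∸ 1) C ⌊ p ∸ 1 /2⌋))
    ⊔ (2 + 2 * ((p ∸ 1) C ⌊ p ∸ 1 /2⌋)))
theorem4p16 p q (s≤s (s≤s (s≤s (s≤s (z≤n {n}))))) _ D _ (dist≤2 , _) four-types =
  ≤-trans q≤levelSum (levelSum≤ n (image τ) (trans (sym nonemptyV₂Count≡) four-types))
  where open AllDistances≤2 D dist≤2
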